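{- Let $G=(V,E)$ be a loopless (multi)graph with $m$ edges, let $\mathcal{D}\subseteq\mathbb{R}^V$ be the set of orientations of $G$, and let $f(b)=\sum_{u\in V}b_u^2$ on $\mathcal{D}$. Then the curvature constant satisfies $2m\le C_f\le2\sum_{u\in V}\deg_G(u)^2$.
   Context: An orientation: assign to each edge $uv$ numbers $x_{uv},x_{vu}\ge0$ with $x_{uv}+x_{vu}=1$; the vector $d\in\mathbb{R}^V$ with $d_u=\sum_{v:uv\in E}x_{uv}$ is an orientation. Curvature constant: $C_f=\sup_{x,s\in\mathcal{D},\gamma\in[0,1],y=x+\gamma(s-x)}\frac{2}{\gamma^2}(f(y)-f(x)-\langle y-x,\nabla f(x)\rangle)$.
   Formalization: The edge weights $x_{uv}$, the orientations in $\mathcal{D}$ and the parameter γ of the curvature constant are taken over the rationals instead of the reals. -}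

module Defs where

open import Data.Nat as ℕ using (ℕ; zero; suc)
open import Data.Fin using (Fin; zero; suc; _≟_)
open import Data.Product using (_×_; _,_; proj₁; proj₂; Σ; ∃)
open import Data.List using ([]; _∷_)
open import Data.List using (List; length; map)
open import Data.Nat.ListAction using (sum)
open import Data.Unit using (⊤)
open import Data.Empty using (⊥)
open import Data.Rational as ℚ using (ℚ; 0ℚ; 1ℚ; _+_; _*_; _-_; _≤_; _<_; 1/_; >-nonZero)
open import Relation.Nullary using (¬_; yes; no)
open import Relation.Binary.PropositionalEquality using (_≡_)

∑ : (n : ℕ) → (Fin n → ℚ) → ℚ
∑ zero    f = 0ℚ
∑ (suc n) f = f zero + ∑ n (λ i → f (suc i))

-- A (multi)graph on vertex set Fin n: a list of edges, each edge an ordered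
-- pair of endpoints (the order is only a labelling; an orientation decides direction).
Edge : ℕ → Set
Edge n = Fin n × Fin n

Loopless : {n : ℕ} → List (Edge n) → Set
Loopless [] = ⊤
Loopless (e ∷ es) = (¬ (proj₁ e ≡ proj₂ e)) × Loopless es

-- degree: number of edge-endpoints equal to u (loopless, so = number of incident edges)
[_≟_]ℕ : {n : ℕ} → Fin n → Fin n → ℕ
[ u ≟ v ]ℕ with u ≟ v
... | yes _ = 1
... | no  _ = 0

deg : {n : ℕ} → List (Edge n) → Fin n → ℕ
deg es u = sum (map (λ e → [ u ≟ proj₁ e ]ℕ ℕ.+ [ u ≟ proj₂ e ]ℕ) es)

[_≟_]ℚ : {n : ℕ} → Fin n → Fin n → ℚ
[ u ≟ v ]ℚ with u ≟ v
... | yes _ = 1ℚ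
... | no  _ = 0ℚ

-- An edge weighting: for edge e = (a , b), w e = x_{ab} and x_{ba} = 1 - w e.
-- The orientation vector d_u = Σ_{e ∋ u} x_{u, other end}.
orientVec : {n : ℕ} → List (Edge n) → List ℚ → Fin n → ℚ
orientVec (e ∷ es) (w ∷ ws) u =
  [ u ≟ proj₁ e ]ℚ * w + [ u ≟ proj₂ e ]ℚ * (1ℚ - w) + orientVec es ws u
orientVec _ _ u = 0ℚ

ValidWeights : {n : ℕ} → List (Edge n) → List ℚ → Set
ValidWeights [] [] = ⊤
ValidWeights (e ∷ es) (w ∷ ws) = (0ℚ ≤ w × w ≤ 1ℚ) × ValidWeights es ws
ValidWeights _ _ = ⊥

IsOrientation : {n : ℕ} → List (Edge n) → (Fin n → ℚ) → Set
IsOrientation es d = Σ (List ℚ) λ ws → ValidWeights es ws × (∀ u → d u ≡ orientVec es ws u)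

f : {n : ℕ} → (Fin n → ℚ) → ℚ
f {n} b = ∑ n (λ u → b u * b u)

∇f : {n : ℕ} → (Fin n → ℚ) → Fin n → ℚ
∇f b u = (1ℚ + 1ℚ) * b u

⟨_,_⟩ : {n : ℕ} → (Fin n → ℚ) → (Fin n → ℚ) → ℚ
⟨_,_⟩ {n} a b = ∑ n (λ u → a u * b u)

-- the quantity under the sup in the curvature constant, for γ > 0
curvQuot : {n : ℕ} → (x s : Fin n → ℚ) → (γ : ℚ) → 0ℚ < γ → ℚ
curvQuot x s γ γ>0 =
  let y  = λ u → x u + γ * (s u - x u)
      ig = 1/_ γ {{>-nonZero γ>0}}
  in ((1ℚ + 1ℚ) * ig * ig) * (f y - f x - ⟨ (λ u → y u - x u) , ∇f x ⟩)

CurvLE : {n : ℕ} → List (Edge n) → ℚ → Set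
CurvLE {n} es B = ∀ (x s : Fin n → ℚ) → IsOrientation es x → IsOrientation es s →
  ∀ γ (γ>0 : 0ℚ < γ) → γ ≤ 1ℚ → curvQuot x s γ γ>0 ≤ B

-- A ≤ C_f  (A ≤ sup: every ε > 0 admits a point with quotient > A - ε)
CurvGE : {n : ℕ} → List (Edge n) → ℚ → Set
CurvGE {n} es A = ∀ (ε : ℚ) → 0ℚ < ε →
  Σ (Fin n → ℚ) λ x → Σ (Fin n → ℚ) λ s → Σ ℚ λ γ → Σ (0ℚ < γ) λ γ>0 →
    IsOrientation es x × IsOrientation es s × γ ≤ 1ℚ × (A - ε < curvQuot x s γ γ>0)

sumSqDegAux : (k : ℕ) {n : ℕ} → (Fin k → Fin n) → List (Edge n) → ℕ
sumSqDegAux zero    ι es = 0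
sumSqDegAux (suc k) ι es = deg es (ι zero) ℕ.* deg es (ι zero) ℕ.+ sumSqDegAux k (λ i → ι (suc i)) es

sumSqDeg : {n : ℕ} → List (Edge n) → ℕ
sumSqDeg {n} es = sumSqDegAux n (λ i → i) es

{-# OPTIONS --safe #-}
module Submission where

-- For the quadratic f the curvature quotient does not depend on γ: the Bregman divergence
-- f y − f x − ⟨y − x, ∇f x⟩ is ‖y − x‖², so the quotient is 2‖s − x‖².
-- Upper bound: every coordinate d_u of an orientation lies in [0, deg u], hence
-- (s_u − x_u)² ≤ deg(u)².
-- Lower bound: take s to be the reversal of x, so that x_u − s_u is the out-degree minus the
-- in-degree of u. Adding an edge ab oriented with sign σ = ±1 changes Σ_u (x_u − s_u)² by
-- 2 + 2σ (D_a − D_b), where D is the imbalance of the edges oriented so far; choosing σ with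
-- the sign of D_a − D_b makes every edge contribute at least 2, so the quotient is ≥ 4m ≥ 2m.

open import Defs
open import Algebra.Bundles using (Ring)
open import Data.Empty using (⊥-elim)
open import Data.Fin using (Fin; zero; suc; _≟_; punchIn)
open import Data.Fin.Properties using (punchInᵢ≢i)
import Data.Integer as ℤ
open import Data.Integer using (+_)
import Data.Integer.Properties as ℤ
open import Data.List using (List; []; _∷_; length; map)
open import Data.Nat as ℕ using (ℕ)
open import Data.Nat.Coprimality as Coprime using (Coprime; 1-coprimeTo)
import Data.Nat.Properties as ℕ
open import Data.Product using (_×_; _,_; proj₁; proj₂)
open import Data.Rational
  using (ℚ; _/_; 0ℚ; 1ℚ; _+_; _*_; _-_; -_; _≤_; _<_; mkℚ; 1/_; >-nonZero; nonNegative)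
open import Data.Rational.Properties
  using (≤-refl; ≤-reflexive; ≤-trans; <-≤-trans; _≤?_; ≰⇒>; <⇒≤; +-mono-≤; +-monoʳ-≤; +-monoʳ-<;
         neg-antimono-≤; neg-antimono-<; *-monoˡ-≤-nonNeg; nonNegative⁻¹; positive⁻¹; nonNeg*nonNeg⇒nonNeg;
         normalize-nonNeg; normalize-coprime; /-cong; +-identityˡ; +-identityʳ; +-comm; +-assoc; +-inverseʳ;
         *-zeroˡ; *-identityˡ; *-identityʳ; *-inverseˡ; +-*-ring; module ≤-Reasoning)
open import Data.Rational.Solver using (module +-*-Solver)
open import Data.Unit using (tt)
open import Data.Vec.Functional using (Vector)
open import Function using (_∘_)
open import Relation.Binary.PropositionalEquality
open import Relation.Nullary using (yes; no)

open import Algebra.Properties.Semiring.Sum (Ring.semiring +-*-ring)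
  using (sum; sum-cong-≗; sum-replicate-zero; sum-remove; ∑-distrib-+; *-distribˡ-sum)
open +-*-Solver

2ℚ : ℚ
2ℚ = 1ℚ + 1ℚ

sq : ℚ → ℚ
sq p = p * p

fromℕ : ℕ → ℚ
fromℕ k = + k / 1

-- The middle term unfolds to (+ 1 ℤ.* + 1 ℤ.+ + k ℤ.* + 1) / 1.
fromℕ-suc : ∀ k → fromℕ (ℕ.suc k) ≡ 1ℚ + fromℕ k
fromℕ-suc k = begin
  + ℕ.suc k / 1
    ≡⟨ /-cong {p₂ = + 1 ℤ.* + 1 ℤ.+ + k ℤ.* + 1} (cong (λ i → + 1 ℤ.+ i) (sym (ℤ.*-identityʳ (+ k)))) refl ⟩
  1ℚ + mkℚ (+ k) 0 k⊥1
    ≡⟨ cong (λ q → 1ℚ + q) (sym (normalize-coprime k⊥1)) ⟩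
  1ℚ + fromℕ k
    ∎
  where
  open ≡-Reasoning
  k⊥1 : Coprime k 1
  k⊥1 = Coprime.sym (1-coprimeTo k)

fromℕ-+ : ∀ a b → fromℕ (a ℕ.+ b) ≡ fromℕ a + fromℕ b
fromℕ-+ ℕ.zero    b = sym (+-identityˡ (fromℕ b))
fromℕ-+ (ℕ.suc a) b = begin
  fromℕ (ℕ.suc (a ℕ.+ b))      ≡⟨ fromℕ-suc (a ℕ.+ b) ⟩
  1ℚ + fromℕ (a ℕ.+ b)         ≡⟨ cong (λ q → 1ℚ + q) (fromℕ-+ a b) ⟩
  1ℚ + (fromℕ a + fromℕ b)     ≡⟨ sym (+-assoc 1ℚ (fromℕ a) (fromℕ b)) ⟩
  (1ℚ + fromℕ a) + fromℕ b     ≡⟨ cong (_+ fromℕ b) (sym (fromℕ-suc a)) ⟩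
  fromℕ (ℕ.suc a) + fromℕ b    ∎
  where open ≡-Reasoning

fromℕ-* : ∀ a b → fromℕ (a ℕ.* b) ≡ fromℕ a * fromℕ b
fromℕ-* ℕ.zero    b = sym (*-zeroˡ (fromℕ b))
fromℕ-* (ℕ.suc a) b = begin
  fromℕ (b ℕ.+ a ℕ.* b)        ≡⟨ fromℕ-+ b (a ℕ.* b) ⟩
  fromℕ b + fromℕ (a ℕ.* b)    ≡⟨ cong (λ q → fromℕ b + q) (fromℕ-* a b) ⟩
  fromℕ b + fromℕ a * fromℕ b  ≡⟨ solve 2 (λ x y → y :+ x :* y := (con 1ℚ :+ x) :* y) refl (fromℕ a) (fromℕ b) ⟩
  (1ℚ + fromℕ a) * fromℕ b     ≡⟨ cong (_* fromℕ b) (sym (fromℕ-suc a)) ⟩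
  fromℕ (ℕ.suc a) * fromℕ b    ∎
  where open ≡-Reasoning

0≤fromℕ : ∀ k → 0ℚ ≤ fromℕ k
0≤fromℕ k = nonNegative⁻¹ (fromℕ k) {{normalize-nonNeg k 1}}

p≤q⇒0≤q-p : ∀ {p q} → p ≤ q → 0ℚ ≤ q - p
p≤q⇒0≤q-p {p} {q} p≤q = subst (_≤ q - p) (+-inverseʳ p) (+-mono-≤ p≤q (≤-refl { - p}))

0≤q-p⇒p≤q : ∀ {p q} → 0ℚ ≤ q - p → p ≤ q
0≤q-p⇒p≤q {p} {q} 0≤q-p = subst₂ _≤_ (+-identityˡ p) (solve 2 (λ p q → (q :- p) :+ p := q) refl p q)
  (+-mono-≤ 0≤q-p (≤-refl {p}))

0≤p∧0≤q⇒0≤p*q : ∀ {p q} → 0ℚ ≤ p → 0ℚ ≤ q → 0ℚ ≤ p * q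
0≤p∧0≤q⇒0≤p*q {p} {q} 0≤p 0≤q =
  nonNegative⁻¹ (p * q) {{nonNeg*nonNeg⇒nonNeg p {{nonNegative 0≤p}} q {{nonNegative 0≤q}}}}

0≤p∧q≤1⇒p*q≤p : ∀ {p q} → 0ℚ ≤ p → q ≤ 1ℚ → p * q ≤ p
0≤p∧q≤1⇒p*q≤p {p} {q} 0≤p q≤1 = subst (p * q ≤_) (*-identityʳ p) (*-monoˡ-≤-nonNeg p {{nonNegative 0≤p}} q≤1)

0≤p⇒p≤2p : ∀ {p} → 0ℚ ≤ p → p ≤ 2ℚ * p
0≤p⇒p≤2p {p} 0≤p = subst₂ _≤_ (+-identityʳ p) (solve 1 (λ p → p :+ p := con 2ℚ :* p) refl p)
  (+-mono-≤ (≤-refl {p}) 0≤p)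

complement-bounds : ∀ {w} → 0ℚ ≤ w → w ≤ 1ℚ → 0ℚ ≤ 1ℚ - w × 1ℚ - w ≤ 1ℚ
complement-bounds 0≤w w≤1 = p≤q⇒0≤q-p w≤1 , +-monoʳ-≤ 1ℚ (neg-antimono-≤ 0≤w)

∑≡sum : ∀ n (g : Fin n → ℚ) → ∑ n g ≡ sum g
∑≡sum ℕ.zero    g = refl
∑≡sum (ℕ.suc n) g = cong (λ q → g zero + q) (∑≡sum n (λ i → g (suc i)))

sum-mono-≤ : ∀ {n} {g h : Vector ℚ n} → (∀ i → g i ≤ h i) → sum g ≤ sum h
sum-mono-≤ {ℕ.zero}  _   = ≤-refl
sum-mono-≤ {ℕ.suc n} g≤h = +-mono-≤ (g≤h zero) (sum-mono-≤ (λ i → g≤h (suc i)))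

δ-refl : ∀ {n} (a : Fin n) → [ a ≟ a ]ℚ ≡ 1ℚ
δ-refl a with a ≟ a
... | yes _   = refl
... | no  a≢a = ⊥-elim (a≢a refl)

δ-≢ : ∀ {n} {u a : Fin n} → u ≢ a → [ u ≟ a ]ℚ ≡ 0ℚ
δ-≢ {u = u} {a} u≢a with u ≟ a
... | yes u≡a = ⊥-elim (u≢a u≡a)
... | no  _   = refl

0≤δ : ∀ {n} (u a : Fin n) → 0ℚ ≤ [ u ≟ a ]ℚ
0≤δ u a with u ≟ a
... | yes _ = 0≤fromℕ 1
... | no  _ = ≤-refl

fromℕ-δ : ∀ {n} (u a : Fin n) → fromℕ [ u ≟ a ]ℕ ≡ [ u ≟ a ]ℚ
fromℕ-δ u a with u ≟ a
... | yes _ = refl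
... | no  _ = refl

sum-δ : ∀ {n} (a : Fin n) (g : Vector ℚ n) → sum (λ u → [ u ≟ a ]ℚ * g u) ≡ g a
sum-δ {ℕ.suc n} a g = begin
  sum t                              ≡⟨ sum-remove {i = a} t ⟩
  t a + sum (λ j → t (punchIn a j))  ≡⟨ cong₂ _+_ (cong (_* g a) (δ-refl a)) (sum-cong-≗ vanishes) ⟩
  1ℚ * g a + sum {n} (λ _ → 0ℚ)      ≡⟨ cong₂ _+_ (*-identityˡ (g a)) (sum-replicate-zero n) ⟩
  g a + 0ℚ                           ≡⟨ +-identityʳ (g a) ⟩
  g a                                ∎
  where
  open ≡-Reasoning
  t : Vector ℚ (ℕ.suc n)
  t u = [ u ≟ a ]ℚ * g u
  vanishes : ∀ j → t (punchIn a j) ≡ 0ℚ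
  vanishes j = trans (cong (_* g (punchIn a j)) (δ-≢ (punchInᵢ≢i a j))) (*-zeroˡ (g (punchIn a j)))

f-Bregman : ∀ {n} (x y : Fin n → ℚ) →
  f y - f x - ⟨ (λ u → y u - x u) , ∇f x ⟩ ≡ sum (λ u → sq (y u - x u))
f-Bregman {n} x y = begin
  f y - f x - P                         ≡⟨ cong (λ q → q - f x - P) f-y ⟩
  (f x + P) + D - f x - P               ≡⟨ solve 3 (λ F P D → (F :+ P) :+ D :- F :- P := D) refl (f x) P D ⟩
  D                                     ∎
  where
  open ≡-Reasoning
  P = ⟨ (λ u → y u - x u) , ∇f x ⟩
  D = sum (λ u → sq (y u - x u))
  sq-x sq-y linear sq-y-x : Fin n → ℚ
  sq-x u = x u * x u
  sq-y u = y u * y u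
  linear u = (y u - x u) * ∇f x u
  sq-y-x u = sq (y u - x u)
  expand : ∀ u → sq-y u ≡ (sq-x u + linear u) + sq-y-x u
  expand u = solve 2 (λ x y → y :* y := (x :* x :+ (y :- x) :* ((con 1ℚ :+ con 1ℚ) :* x)) :+ (y :- x) :* (y :- x))
    refl (x u) (y u)
  f-y : f y ≡ (f x + P) + D
  f-y = begin
    f y                                          ≡⟨ ∑≡sum n sq-y ⟩
    sum sq-y                                     ≡⟨ sum-cong-≗ expand ⟩
    sum (λ u → (sq-x u + linear u) + sq-y-x u)   ≡⟨ ∑-distrib-+ (λ u → sq-x u + linear u) sq-y-x ⟩
    sum (λ u → sq-x u + linear u) + D            ≡⟨ cong (_+ D) (∑-distrib-+ sq-x linear) ⟩
    (sum sq-x + sum linear) + D                  ≡⟨ cong (_+ D) (cong₂ _+_ (∑≡sum n sq-x) (∑≡sum n linear)) ⟨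
    (f x + P) + D                                ∎

curvQuot≡2∑sq : ∀ {n} (x s : Fin n → ℚ) γ (γ>0 : 0ℚ < γ) →
  curvQuot x s γ γ>0 ≡ 2ℚ * sum (λ u → sq (s u - x u))
curvQuot≡2∑sq {n} x s γ γ>0 = begin
  2ℚ * γ⁻¹ * γ⁻¹ * (f y - f x - ⟨ (λ u → y u - x u) , ∇f x ⟩)
                                        ≡⟨ cong (2ℚ * γ⁻¹ * γ⁻¹ *_) (f-Bregman x y) ⟩
  2ℚ * γ⁻¹ * γ⁻¹ * sum (λ u → sq (y u - x u))
                                        ≡⟨ cong (2ℚ * γ⁻¹ * γ⁻¹ *_) (sum-cong-≗ step) ⟩
  2ℚ * γ⁻¹ * γ⁻¹ * sum (λ u → γ * γ * sq (s u - x u))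
                                        ≡⟨ cong (2ℚ * γ⁻¹ * γ⁻¹ *_) (*-distribˡ-sum (γ * γ) (λ u → sq (s u - x u))) ⟨
  2ℚ * γ⁻¹ * γ⁻¹ * (γ * γ * S)          ≡⟨ solve 3 (λ a g S → con 2ℚ :* a :* a :* (g :* g :* S)
                                                           := con 2ℚ :* (a :* g) :* (a :* g) :* S) refl γ⁻¹ γ S ⟩
  2ℚ * (γ⁻¹ * γ) * (γ⁻¹ * γ) * S        ≡⟨ cong (λ r → 2ℚ * r * r * S) (*-inverseˡ γ {{>-nonZero γ>0}}) ⟩
  2ℚ * 1ℚ * 1ℚ * S                      ≡⟨ cong (_* S) (*-identityʳ (2ℚ * 1ℚ)) ⟩
  2ℚ * 1ℚ * S                           ≡⟨ cong (_* S) (*-identityʳ 2ℚ) ⟩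
  2ℚ * S                                ∎
  where
  open ≡-Reasoning
  γ⁻¹ = 1/_ γ {{>-nonZero γ>0}}
  y : Fin n → ℚ
  y u = x u + γ * (s u - x u)
  S = sum (λ u → sq (s u - x u))
  step : ∀ u → sq (y u - x u) ≡ γ * γ * sq (s u - x u)
  step u = solve 3 (λ x s g → (x :+ g :* (s :- x) :- x) :* (x :+ g :* (s :- x) :- x)
                              := g :* g :* ((s :- x) :* (s :- x)))
    refl (x u) (s u) γ

fromℕ-deg-∷ : ∀ {n} (e : Edge n) es u →
  fromℕ (deg (e ∷ es) u) ≡ ([ u ≟ proj₁ e ]ℚ + [ u ≟ proj₂ e ]ℚ) + fromℕ (deg es u)
fromℕ-deg-∷ (a , b) es u = begin
  fromℕ ((δa ℕ.+ δb) ℕ.+ deg es u)                ≡⟨ fromℕ-+ (δa ℕ.+ δb) (deg es u) ⟩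
  fromℕ (δa ℕ.+ δb) + fromℕ (deg es u)            ≡⟨ cong (_+ fromℕ (deg es u)) (fromℕ-+ δa δb) ⟩
  (fromℕ δa + fromℕ δb) + fromℕ (deg es u)        ≡⟨ cong (_+ fromℕ (deg es u)) (cong₂ _+_ (fromℕ-δ u a) (fromℕ-δ u b)) ⟩
  ([ u ≟ a ]ℚ + [ u ≟ b ]ℚ) + fromℕ (deg es u)    ∎
  where
  open ≡-Reasoning
  δa = [ u ≟ a ]ℕ
  δb = [ u ≟ b ]ℕ

0≤orientVec : ∀ {n} (es : List (Edge n)) ws → ValidWeights es ws → ∀ u → 0ℚ ≤ orientVec es ws u
0≤orientVec []       []       _                       u = ≤-refl
0≤orientVec (e ∷ es) (w ∷ ws) ((0≤w , w≤1) , valid) u =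
  +-mono-≤ (+-mono-≤ (0≤p∧0≤q⇒0≤p*q (0≤δ u (proj₁ e)) 0≤w)
                     (0≤p∧0≤q⇒0≤p*q (0≤δ u (proj₂ e)) (proj₁ (complement-bounds 0≤w w≤1))))
           (0≤orientVec es ws valid u)

orientVec≤deg : ∀ {n} (es : List (Edge n)) ws → ValidWeights es ws → ∀ u → orientVec es ws u ≤ fromℕ (deg es u)
orientVec≤deg []       []       _                       u = ≤-refl
orientVec≤deg (e ∷ es) (w ∷ ws) ((0≤w , w≤1) , valid) u = begin
  [ u ≟ proj₁ e ]ℚ * w + [ u ≟ proj₂ e ]ℚ * (1ℚ - w) + orientVec es ws u
    ≤⟨ +-mono-≤ (+-mono-≤ (0≤p∧q≤1⇒p*q≤p (0≤δ u (proj₁ e)) w≤1)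
                          (0≤p∧q≤1⇒p*q≤p (0≤δ u (proj₂ e)) (proj₂ (complement-bounds 0≤w w≤1))))
                (orientVec≤deg es ws valid u) ⟩
  ([ u ≟ proj₁ e ]ℚ + [ u ≟ proj₂ e ]ℚ) + fromℕ (deg es u)
    ≡⟨ fromℕ-deg-∷ e es u ⟨
  fromℕ (deg (e ∷ es) u)
    ∎
  where open ≤-Reasoning

sq-diff≤sq : ∀ {x y d} → 0ℚ ≤ x → x ≤ d → 0ℚ ≤ y → y ≤ d → sq (y - x) ≤ sq d
sq-diff≤sq {x} {y} {d} 0≤x x≤d 0≤y y≤d = 0≤q-p⇒p≤q (subst (0ℚ ≤_) factor
  (0≤p∧0≤q⇒0≤p*q (+-mono-≤ (p≤q⇒0≤q-p y≤d) 0≤x) (+-mono-≤ (p≤q⇒0≤q-p x≤d) 0≤y)))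
  where
  factor : ((d - y) + x) * ((d - x) + y) ≡ sq d - sq (y - x)
  factor = solve 3 (λ x y d → ((d :- y) :+ x) :* ((d :- x) :+ y) := d :* d :- (y :- x) :* (y :- x)) refl x y d

fromℕ-sumSqDeg : ∀ {n} (E : List (Edge n)) → fromℕ (sumSqDeg E) ≡ sum (λ u → sq (fromℕ (deg E u)))
fromℕ-sumSqDeg {n} E = go n (λ u → u)
  where
  go : ∀ k (ι : Fin k → Fin n) → fromℕ (sumSqDegAux k ι E) ≡ sum (λ i → sq (fromℕ (deg E (ι i))))
  go ℕ.zero    ι = refl
  go (ℕ.suc k) ι = trans (fromℕ-+ (deg E (ι zero) ℕ.* deg E (ι zero)) _)
    (cong₂ _+_ (fromℕ-* (deg E (ι zero)) (deg E (ι zero))) (go k (λ i → ι (suc i))))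

curvLE-sumSqDeg : ∀ {n} (E : List (Edge n)) → CurvLE E (fromℕ (2 ℕ.* sumSqDeg E))
curvLE-sumSqDeg E x s (wx , valid-x , x≡) (ws , valid-s , s≡) γ γ>0 _ = begin
  curvQuot x s γ γ>0                       ≡⟨ curvQuot≡2∑sq x s γ γ>0 ⟩
  2ℚ * sum (λ u → sq (s u - x u))          ≤⟨ *-monoˡ-≤-nonNeg 2ℚ (sum-mono-≤ coordinate-bound) ⟩
  2ℚ * sum (λ u → sq (fromℕ (deg E u)))    ≡⟨ cong (2ℚ *_) (fromℕ-sumSqDeg E) ⟨
  2ℚ * fromℕ (sumSqDeg E)                  ≡⟨ fromℕ-* 2 (sumSqDeg E) ⟨
  fromℕ (2 ℕ.* sumSqDeg E)                 ∎
  where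
  open ≤-Reasoning
  coordinate-bound : ∀ u → sq (s u - x u) ≤ sq (fromℕ (deg E u))
  coordinate-bound u rewrite x≡ u | s≡ u =
    sq-diff≤sq (0≤orientVec E wx valid-x u) (orientVec≤deg E wx valid-x u)
               (0≤orientVec E ws valid-s u) (orientVec≤deg E ws valid-s u)

opposite : List ℚ → List ℚ
opposite = map (λ w → 1ℚ - w)

opposite-valid : ∀ {n} (es : List (Edge n)) ws → ValidWeights es ws → ValidWeights es (opposite ws)
opposite-valid []       []       _                       = tt
opposite-valid (e ∷ es) (w ∷ ws) ((0≤w , w≤1) , valid) = complement-bounds 0≤w w≤1 , opposite-valid es ws valid

imbalance : ∀ {n} → List (Edge n) → List ℚ → Fin n → ℚ
imbalance es ws u = orientVec es ws u - orientVec es (opposite ws) u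

sign : ℚ → ℚ
sign w = w - (1ℚ - w)

imbalance-∷ : ∀ {n} (e : Edge n) es w ws u →
  imbalance (e ∷ es) (w ∷ ws) u ≡ ([ u ≟ proj₁ e ]ℚ - [ u ≟ proj₂ e ]ℚ) * sign w + imbalance es ws u
imbalance-∷ e es w ws u =
  solve 5 (λ I J w O Ō → (I :* w :+ J :* (con 1ℚ :- w) :+ O)
                           :- (I :* (con 1ℚ :- w) :+ J :* (con 1ℚ :- (con 1ℚ :- w)) :+ Ō)
                         := (I :- J) :* (w :- (con 1ℚ :- w)) :+ (O :- Ō))
    refl [ u ≟ proj₁ e ]ℚ [ u ≟ proj₂ e ]ℚ w (orientVec es ws u) (orientVec es (opposite ws) u)

energy : ∀ {n} → List (Edge n) → List ℚ → ℚ
energy es ws = sum (λ u → sq (imbalance es ws u))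

energy-∷ : ∀ {n} (e : Edge n) es w ws → proj₁ e ≢ proj₂ e →
  energy (e ∷ es) (w ∷ ws)
    ≡ energy es ws + (2ℚ * sq (sign w) + 2ℚ * (sign w * (imbalance es ws (proj₁ e) - imbalance es ws (proj₂ e))))
energy-∷ {n} (a , b) es w ws a≢b = begin
  sum (λ u → sq (imbalance ((a , b) ∷ es) (w ∷ ws) u))
    ≡⟨ sum-cong-≗ expand ⟩
  sum (λ u → sq (D u) + ([ u ≟ a ]ℚ * hᵤ u + [ u ≟ b ]ℚ * - hᵤ u))
    ≡⟨ ∑-distrib-+ (λ u → sq (D u)) (λ u → [ u ≟ a ]ℚ * hᵤ u + [ u ≟ b ]ℚ * - hᵤ u) ⟩
  energy es ws + sum (λ u → [ u ≟ a ]ℚ * hᵤ u + [ u ≟ b ]ℚ * - hᵤ u)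
    ≡⟨ cong (λ q → energy es ws + q) cross-terms ⟩
  energy es ws + (2ℚ * sq σ + 2ℚ * (σ * (D a - D b)))
    ∎
  where
  open ≡-Reasoning
  σ = sign w
  D = imbalance es ws
  h : ℚ → ℚ → ℚ → ℚ
  h I J d = (I - J) * σ * σ + 2ℚ * σ * d
  hᵤ : Fin n → ℚ
  hᵤ u = h [ u ≟ a ]ℚ [ u ≟ b ]ℚ (D u)
  -- A polynomial identity in I and J, so no property of the indicators is needed before
  -- sum-δ evaluates them at the two endpoints.
  expand : ∀ u → sq (imbalance ((a , b) ∷ es) (w ∷ ws) u)
                 ≡ sq (D u) + ([ u ≟ a ]ℚ * hᵤ u + [ u ≟ b ]ℚ * - hᵤ u)
  expand u = trans (cong sq (imbalance-∷ (a , b) es w ws u))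
    (solve 4 (λ I J σ d → ((I :- J) :* σ :+ d) :* ((I :- J) :* σ :+ d)
                          := d :* d :+ (I :* ((I :- J) :* σ :* σ :+ con 2ℚ :* σ :* d)
                                        :+ J :* (:- ((I :- J) :* σ :* σ :+ con 2ℚ :* σ :* d))))
       refl [ u ≟ a ]ℚ [ u ≟ b ]ℚ σ (D u))
  cross-terms : sum (λ u → [ u ≟ a ]ℚ * hᵤ u + [ u ≟ b ]ℚ * - hᵤ u) ≡ 2ℚ * sq σ + 2ℚ * (σ * (D a - D b))
  cross-terms = begin
    sum (λ u → [ u ≟ a ]ℚ * hᵤ u + [ u ≟ b ]ℚ * - hᵤ u)
      ≡⟨ ∑-distrib-+ (λ u → [ u ≟ a ]ℚ * hᵤ u) (λ u → [ u ≟ b ]ℚ * - hᵤ u) ⟩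
    sum (λ u → [ u ≟ a ]ℚ * hᵤ u) + sum (λ u → [ u ≟ b ]ℚ * - hᵤ u)
      ≡⟨ cong₂ _+_ (sum-δ a hᵤ) (sum-δ b (λ u → - hᵤ u)) ⟩
    h [ a ≟ a ]ℚ [ a ≟ b ]ℚ (D a) + - h [ b ≟ a ]ℚ [ b ≟ b ]ℚ (D b)
      ≡⟨ cong₂ (λ p q → h p q (D a) + - h [ b ≟ a ]ℚ [ b ≟ b ]ℚ (D b)) (δ-refl a) (δ-≢ a≢b) ⟩
    h 1ℚ 0ℚ (D a) + - h [ b ≟ a ]ℚ [ b ≟ b ]ℚ (D b)
      ≡⟨ cong₂ (λ p q → h 1ℚ 0ℚ (D a) + - h p q (D b)) (δ-≢ (a≢b ∘ sym)) (δ-refl b) ⟩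
    h 1ℚ 0ℚ (D a) + - h 0ℚ 1ℚ (D b)
      ≡⟨ solve 3 (λ σ x y → ((con 1ℚ :- con 0ℚ) :* σ :* σ :+ con 2ℚ :* σ :* x)
                            :+ :- ((con 0ℚ :- con 1ℚ) :* σ :* σ :+ con 2ℚ :* σ :* y)
                            := con 2ℚ :* (σ :* σ) :+ con 2ℚ :* (σ :* (x :- y))) refl σ (D a) (D b) ⟩
    2ℚ * sq σ + 2ℚ * (σ * (D a - D b))
      ∎

choose : ℚ → ℚ → ℚ
choose p q with q ≤? p
... | yes _ = 1ℚ
... | no  _ = 0ℚ

choose-bounds : ∀ p q → 0ℚ ≤ choose p q × choose p q ≤ 1ℚ
choose-bounds p q with q ≤? p
... | yes _ = 0≤fromℕ 1 , ≤-refl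
... | no  _ = ≤-refl , 0≤fromℕ 1

sq-sign-choose : ∀ p q → sq (sign (choose p q)) ≡ 1ℚ
sq-sign-choose p q with q ≤? p
... | yes _ = refl
... | no  _ = refl

0≤sign-choose* : ∀ p q → 0ℚ ≤ sign (choose p q) * (p - q)
0≤sign-choose* p q with q ≤? p
... | yes q≤p = subst (0ℚ ≤_) (sym (*-identityˡ (p - q))) (p≤q⇒0≤q-p q≤p)
... | no  q≰p = subst (0ℚ ≤_) (solve 2 (λ p q → q :- p := (:- con 1ℚ) :* (p :- q)) refl p q)
                      (p≤q⇒0≤q-p (<⇒≤ (≰⇒> q≰p)))

greedy : ∀ {n} → List (Edge n) → List ℚ
greedy []             = []
greedy ((a , b) ∷ es) = choose (imbalance es (greedy es) a) (imbalance es (greedy es) b) ∷ greedy es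

greedy-valid : ∀ {n} (es : List (Edge n)) → ValidWeights es (greedy es)
greedy-valid []             = tt
greedy-valid ((a , b) ∷ es) =
  choose-bounds (imbalance es (greedy es) a) (imbalance es (greedy es) b) , greedy-valid es

2*length≤energy-greedy : ∀ {n} (es : List (Edge n)) → Loopless es → fromℕ (2 ℕ.* length es) ≤ energy es (greedy es)
2*length≤energy-greedy {n} []             _                = ≤-reflexive (sym (sum-replicate-zero n))
2*length≤energy-greedy     ((a , b) ∷ es) (a≢b , loopless) = begin
  fromℕ (2 ℕ.* ℕ.suc (length es))            ≡⟨ cong fromℕ (ℕ.*-suc 2 (length es)) ⟩
  fromℕ (2 ℕ.+ 2 ℕ.* length es)              ≡⟨ fromℕ-+ 2 (2 ℕ.* length es) ⟩
  2ℚ + fromℕ (2 ℕ.* length es)               ≡⟨ +-comm 2ℚ (fromℕ (2 ℕ.* length es)) ⟩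
  fromℕ (2 ℕ.* length es) + 2ℚ               ≤⟨ +-mono-≤ (2*length≤energy-greedy es loopless) gain ⟩
  energy es ws + (2ℚ * sq σ + 2ℚ * (σ * (D a - D b)))
                                             ≡⟨ energy-∷ (a , b) es w ws a≢b ⟨
  energy ((a , b) ∷ es) (w ∷ ws)             ∎
  where
  open ≤-Reasoning
  ws = greedy es
  D = imbalance es ws
  w = choose (D a) (D b)
  σ = sign w
  gain : 2ℚ ≤ 2ℚ * sq σ + 2ℚ * (σ * (D a - D b))
  gain = begin
    2ℚ + 0ℚ
      ≤⟨ +-mono-≤ ≤-refl (0≤p∧0≤q⇒0≤p*q (0≤fromℕ 2) (0≤sign-choose* (D a) (D b))) ⟩
    2ℚ * 1ℚ + 2ℚ * (σ * (D a - D b))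
      ≡⟨ cong (λ r → 2ℚ * r + 2ℚ * (σ * (D a - D b))) (sq-sign-choose (D a) (D b)) ⟨
    2ℚ * sq σ + 2ℚ * (σ * (D a - D b))
      ∎

curvQuot-opposite : ∀ {n} (es : List (Edge n)) ws γ (γ>0 : 0ℚ < γ) →
  curvQuot (orientVec es ws) (orientVec es (opposite ws)) γ γ>0 ≡ 2ℚ * energy es ws
curvQuot-opposite es ws γ γ>0 =
  trans (curvQuot≡2∑sq (orientVec es ws) (orientVec es (opposite ws)) γ γ>0) (cong (2ℚ *_) (sum-cong-≗ λ u →
    solve 2 (λ x s → (s :- x) :* (s :- x) := (x :- s) :* (x :- s)) refl
      (orientVec es ws u) (orientVec es (opposite ws) u)))

attained⇒CurvGE : ∀ {n} (E : List (Edge n)) {A} x s γ (γ>0 : 0ℚ < γ) →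
  IsOrientation E x → IsOrientation E s → γ ≤ 1ℚ → A ≤ curvQuot x s γ γ>0 → CurvGE E A
attained⇒CurvGE E {A} x s γ γ>0 x∈𝒟 s∈𝒟 γ≤1 A≤q ε ε>0 = x , s , γ , γ>0 , x∈𝒟 , s∈𝒟 , γ≤1 , <-≤-trans A-ε<A A≤q
  where
  A-ε<A : A - ε < A
  A-ε<A = subst (A - ε <_) (+-identityʳ A) (+-monoʳ-< A (neg-antimono-< ε>0))

lemma11 : (n : ℕ) (E : List (Edge n)) → Loopless E →
    CurvGE E ((+ (2 ℕ.* length E)) / 1)
    × CurvLE E ((+ (2 ℕ.* sumSqDeg E)) / 1)
lemma11 n E loopless = curvGE , curvLE-sumSqDeg E
  where
  open ≤-Reasoning
  g = greedy E
  x = orientVec E g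
  s = orientVec E (opposite g)
  0<1 = positive⁻¹ 1ℚ
  2m≤energy = 2*length≤energy-greedy E loopless
  curvGE : CurvGE E (fromℕ (2 ℕ.* length E))
  curvGE = attained⇒CurvGE E x s 1ℚ 0<1
    (g , greedy-valid E , λ _ → refl) (opposite g , opposite-valid E g (greedy-valid E) , λ _ → refl) ≤-refl
    (begin
      fromℕ (2 ℕ.* length E)   ≤⟨ 2m≤energy ⟩
      energy E g               ≤⟨ 0≤p⇒p≤2p (≤-trans (0≤fromℕ (2 ℕ.* length E)) 2m≤energy) ⟩
      2ℚ * energy E g          ≡⟨ curvQuot-opposite E g 1ℚ 0<1 ⟨
      curvQuot x s 1ℚ 0<1      ∎)
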